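{- Let $Q$ be a finite closed down set of pairs $\{c_j,s_k\}$ with associated $p,q,k$ and lengths $I_0,\dots,I_{k-1}$, $II_1,\dots,II_k$ as defined in the context. Then \[|Q|\ge \sum_{j=1}^k II_j\Big(p+I_0+\sum_{\ell=1}^{j-1}(II_\ell+I_\ell)\Big).\]
   Context: $c_1,c_2,\dots$ and $s_1,s_2,\dots$ are distinct vertices; $[i]\times[j]$ denotes $\{\{c_a,s_b\}: a\le i, b\le j\}$. A set $Q$ of pairs $\{c_j,s_k\}$ is closed down if $\{c_a,s_b\}\in Q$ implies $\{c_{a'},s_{b'}\}\in Q$ for all $a'\le a$, $b'\le b$. For an integer $\ell\ge0$, $\nu(\ell,Q)$ is the matching number of the bipartite graph on $\{c_1,\dots,c_\ell\}\cup\{s_1,\dots,s_\ell\}$ with edge set $([\ell]\times[\ell])\setminus Q$. Let $p\ge0$ be the maximum integer with $[p]\times[p]\subseteq Q$, and $q\ge0$ the minimum integer such that $\nu(\ell,Q)=\ell$ for all $\ell\ge p+q$. For $\ell>p$ one has $\nu(\ell,Q)-\nu(\ell-1,Q)\in\{1,2\}$. The integer interval $(p,p+q]$ is divided into consecutive left-open, right-closed intervals with integer endpoints $\mathcal O_0,\mathcal T_1,\mathcal O_1,\mathcal T_2,\dots,\mathcal O_{k-1},\mathcal T_k$, in this order, all nonempty except possibly $\mathcal O_0$, such that $\nu(\ell,Q)-\nu(\ell-1,Q)=1$ for $\ell$ in any $\mathcal O_j$ and $=2$ for $\ell$ in any $\mathcal T_j$. Set $I_j=|\mathcal O_j|$ ($0\le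 j\le k-1$) and $II_j=|\mathcal T_j|$ ($1\le j\le k$). -}

module Defs where

open import Data.Nat using (ℕ; zero; suc; _+_; _*_; _∸_; _≤_; _<_)
open import Data.Product using (_×_; _,_; proj₁; proj₂; ∃-syntax)
open import Data.List using (List; length; map)
open import Data.List.Membership.Propositional using (_∈_; _∉_)
open import Data.List.Relation.Unary.All using (All)
open import Data.List.Relation.Unary.Unique.Propositional using (Unique)
open import Relation.Binary.PropositionalEquality using (_≡_)

-- The pair (a , b) encodes the pair {c_a , s_b}; indices are 1-based.
Pair : Set
Pair = ℕ × ℕ

-- A finite set Q of pairs is represented as a duplicate-free list; |Q| = length.
-- Closed down (with all indices ≥ 1).
record ClosedDown (Q : List Pair) : Set where
  field
    unique    : Unique Q
    positive  : All (λ ab → 1 ≤ proj₁ ab × 1 ≤ proj₂ ab) Q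
    closed    : ∀ a b a′ b′ → (a , b) ∈ Q → 1 ≤ a′ → a′ ≤ a → 1 ≤ b′ → b′ ≤ b →
                (a′ , b′) ∈ Q

SquareIn : ℕ → List Pair → Set
SquareIn i Q = ∀ a b → 1 ≤ a → a ≤ i → 1 ≤ b → b ≤ i → (a , b) ∈ Q

-- A matching in the bipartite graph on {c_1..c_ℓ} ∪ {s_1..s_ℓ} with edge set
-- ([ℓ]×[ℓ]) \ Q : a list of edges with pairwise distinct c-ends and s-ends.
record IsMatching (ℓ : ℕ) (Q : List Pair) (M : List Pair) : Set where
  field
    edges   : All (λ ab → (1 ≤ proj₁ ab × proj₁ ab ≤ ℓ) ×
                          (1 ≤ proj₂ ab × proj₂ ab ≤ ℓ) × ab ∉ Q) M
    c-disj  : Unique (map proj₁ M)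
    s-disj  : Unique (map proj₂ M)

IsMatchingNumber : ℕ → List Pair → ℕ → Set
IsMatchingNumber ℓ Q m =
  (∃[ M ] (IsMatching ℓ Q M × length M ≡ m)) ×
  (∀ M → IsMatching ℓ Q M → length M ≤ m)

sumTo : ℕ → (ℕ → ℕ) → ℕ
sumTo zero    f = 0
sumTo (suc n) f = sumTo n f + f (suc n)

tStart : ℕ → (ℕ → ℕ) → (ℕ → ℕ) → ℕ → ℕ
tStart p I II j = p + I 0 + sumTo (j ∸ 1) (λ l → II l + I l)

{-# OPTIONS --safe #-}

-- Write δ(ℓ) = ℓ − ν(ℓ) and S_j = II_1 + ⋯ + II_j.  As [p]×[p] ⊆ Q, ν(p) = 0 and δ(p) = p; δ is
-- unchanged by O-steps and drops by one at each T-step, so δ = p − S_{j−1} at the left end t_j of 𝒯_j.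
-- If ℓ = p or level ℓ is reached by an O-step, then {c_δ, s_ℓ} or {c_ℓ, s_δ} lies in Q: otherwise, by
-- closedness, a maximum matching at level ℓ − 1 leaves some c_a and some s_b with δ ≤ a, b < ℓ
-- unmatched, and adding {c_a, s_ℓ} and {c_ℓ, s_b} would raise ν by two.  Closedness then gives each
-- row d ≤ δ a hook of ℓ pairs in Q: {c_d}×[p] together with {c_d}×(p, ℓ] or (p, ℓ]×{s_d}.  Hooks of
-- distinct rows are disjoint, and the II_j rows p − S_j < d ≤ p − S_{j−1} get hooks of length t_j.
module Submission where

open import Defs
open import Data.Empty using (⊥-elim)
open import Data.Nat using (ℕ; zero; suc; _+_; _*_; _∸_; _≤_; _<_; z≤n; s≤s; _≤?_; _≟_)
open import Data.Nat.Properties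
open import Data.Nat.Tactic.RingSolver using (solve-∀)
open import Data.Product using (_×_; _,_; proj₁; proj₂; uncurry; ∃-syntax)
open import Data.Product.Properties using (≡-dec)
open import Data.Sum using (_⊎_; inj₁; inj₂)
open import Data.List using (List; []; _∷_; length; map; _++_; applyUpTo; concatMap)
open import Data.List.Properties using (length-map; length-++; length-removeAt′; length-applyUpTo)
open import Data.List.Membership.Propositional using (_∈_; _∉_; find)
open import Data.List.Membership.Propositional.Properties using (∈-applyUpTo⁺; ∈-applyUpTo⁻)
import Data.List.Membership.DecPropositional as DecMembership
open import Data.List.Relation.Unary.All as All using (All; []; _∷_)
import Data.List.Relation.Unary.All.Properties as All
open import Data.List.Relation.Unary.Any using (here; there; index; _─_)
open import Data.List.Relation.Unary.Unique.Propositional using (Unique)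
open import Data.List.Relation.Unary.AllPairs using ([]; _∷_)
import Data.List.Relation.Unary.Unique.Propositional.Properties as Unique
open import Function using (_∘_)
open import Relation.Binary.Definitions using (DecidableEquality)
open import Relation.Binary.PropositionalEquality
open import Relation.Nullary using (¬_; yes; no)

open DecMembership (≡-dec _≟_ _≟_) using (_∈?_)

m<n≤m+[o∸m]⇒n≤o : ∀ {m n o} → m < n → n ≤ m + (o ∸ m) → n ≤ o
m<n≤m+[o∸m]⇒n≤o {m} {n} {o} m<n n≤m+[o∸m] with m ≤? o
... | yes m≤o = subst (n ≤_) (m+[n∸m]≡n m≤o) n≤m+[o∸m]
... | no m≰o  = ⊥-elim (<⇒≱ m<n (≤-trans n≤m+[o∸m] (≤-reflexive m+[o∸m]≡m)))
  where
  m+[o∸m]≡m : m + (o ∸ m) ≡ m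
  m+[o∸m]≡m = trans (cong (m +_) (m≤n⇒m∸n≡0 (<⇒≤ (≰⇒> m≰o)))) (+-identityʳ m)

module _ {A : Set} where

  ∈-─⁺ : ∀ {x y} {xs : List A} (x∈xs : x ∈ xs) → y ∈ xs → x ≢ y → y ∈ (xs ─ x∈xs)
  ∈-─⁺ (here refl) (here refl) x≢y = ⊥-elim (x≢y refl)
  ∈-─⁺ (here refl) (there y∈xs) _  = y∈xs
  ∈-─⁺ (there _)   (here y≡z)  _   = here y≡z
  ∈-─⁺ (there x∈xs) (there y∈xs) x≢y = there (∈-─⁺ x∈xs y∈xs x≢y)

  Unique⇒length≤ : ∀ {xs ys : List A} → Unique xs → All (_∈ ys) xs → length xs ≤ length ys
  Unique⇒length≤ [] [] = z≤n
  Unique⇒length≤ {ys = ys} (x∉xs ∷ xs!) (x∈ys ∷ xs⊆ys) = begin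
    suc _                        ≤⟨ s≤s (Unique⇒length≤ xs! xs⊆ys─x) ⟩
    suc (length (ys ─ x∈ys))     ≡⟨ length-removeAt′ ys (index x∈ys) ⟨
    length ys                    ∎
    where
    open ≤-Reasoning
    xs⊆ys─x = All.zipWith (λ (y∈ys , x≢y) → ∈-─⁺ x∈ys y∈ys x≢y) (xs⊆ys , x∉xs)

  longer⇒∃∉ : DecidableEquality A → ∀ {xs ys : List A} → Unique ys → length xs < length ys →
              ∃[ y ] (y ∈ ys × y ∉ xs)
  longer⇒∃∉ _≟ᴬ_ {xs} {ys} ys! xs<ys =
    find (All.¬All⇒Any¬ (λ y → DecMembership._∈?_ _≟ᴬ_ y xs) ys
                        (λ ys⊆xs → <⇒≱ xs<ys (Unique⇒length≤ ys! ys⊆xs)))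

  ++⁺-separated : ∀ {P : A → Set} {xs ys : List A} → Unique xs → Unique ys →
                  All P xs → All (¬_ ∘ P) ys → Unique (xs ++ ys)
  ++⁺-separated xs! ys! Pxs ¬Pys =
    Unique.++⁺ xs! ys! λ (v∈xs , v∈ys) → All.lookup ¬Pys v∈ys (All.lookup Pxs v∈xs)

range′ : ℕ → ℕ → List ℕ
range′ s n = applyUpTo (s +_) n

length-range′ : ∀ s n → length (range′ s n) ≡ n
length-range′ s n = length-applyUpTo (s +_) n

∈-range′⁺ : ∀ {s n x} → s ≤ x → x < s + n → x ∈ range′ s n
∈-range′⁺ {s} {n} s≤x x<s+n = subst (_∈ range′ s n) (m+[n∸m]≡n s≤x)
  (∈-applyUpTo⁺ (s +_) (+-cancelˡ-< s _ n (subst (_< s + n) (sym (m+[n∸m]≡n s≤x)) x<s+n)))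

∈-range′⁻ : ∀ {s n x} → x ∈ range′ s n → s ≤ x × x < s + n
∈-range′⁻ {s} x∈ with i , i<n , refl ← ∈-applyUpTo⁻ (s +_) x∈ = m≤m+n s i , +-monoʳ-< s i<n

Unique-range′ : ∀ s n → Unique (range′ s n)
Unique-range′ s n = Unique.applyUpTo⁺₁ (s +_) n (λ i<j _ → <⇒≢ (+-monoʳ-< s i<j))

All-range′ : ∀ {P : ℕ → Set} {s n} → (∀ {x} → s ≤ x → x < s + n → P x) → All P (range′ s n)
All-range′ h = All.tabulate (uncurry h ∘ ∈-range′⁻)

∃∉-range′ : ∀ s {n} (xs : List ℕ) → length xs ≤ n → ∃[ a ] (s ≤ a × a ≤ s + n × a ∉ xs)
∃∉-range′ s {n} xs |xs|≤n
  with a , a∈ , a∉ ← longer⇒∃∉ _≟_ (Unique-range′ s (suc n))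
                       (subst (length xs <_) (sym (length-range′ s (suc n))) (s≤s |xs|≤n))
  with s≤a , a<s+1+n ← ∈-range′⁻ a∈
  = a , s≤a , ≤-pred (subst (a <_) (+-suc s n) a<s+1+n) , a∉

module _ {Q : List Pair} where
  open IsMatching

  IsMatching-mono : ∀ {ℓ ℓ′ M} → ℓ ≤ ℓ′ → IsMatching ℓ Q M → IsMatching ℓ′ Q M
  IsMatching-mono ℓ≤ℓ′ M-matching = record
    { edges  = All.map (λ ((1≤a , a≤ℓ) , (1≤b , b≤ℓ) , ab∉Q) →
                          (1≤a , ≤-trans a≤ℓ ℓ≤ℓ′) , (1≤b , ≤-trans b≤ℓ ℓ≤ℓ′) , ab∉Q)
                       (edges M-matching)
    ; c-disj = c-disj M-matching
    ; s-disj = s-disj M-matching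
    }

  IsMatching⇒length≤ : ∀ {ℓ M} → IsMatching ℓ Q M → length M ≤ ℓ
  IsMatching⇒length≤ {ℓ} {M} M-matching = begin
    length M                ≡⟨ length-map proj₁ M ⟨
    length (map proj₁ M)    ≤⟨ Unique⇒length≤ (c-disj M-matching) c-ends⊆[1,ℓ] ⟩
    length (range′ 1 ℓ)     ≡⟨ length-range′ 1 ℓ ⟩
    ℓ                       ∎
    where
    open ≤-Reasoning
    c-ends⊆[1,ℓ] = All.map⁺ (All.map (λ ((1≤a , a≤ℓ) , _) → ∈-range′⁺ 1≤a (s≤s a≤ℓ)) (edges M-matching))

  IsMatchingNumber⇒≤ : ∀ {ℓ m} → IsMatchingNumber ℓ Q m → m ≤ ℓ
  IsMatchingNumber⇒≤ ((M , M-matching , refl) , _) = IsMatching⇒length≤ M-matching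

  SquareIn⇒IsMatchingNumber≡0 : ∀ {p m} → SquareIn p Q → IsMatchingNumber p Q m → m ≡ 0
  SquareIn⇒IsMatchingNumber≡0 _ (([] , _ , refl) , _) = refl
  SquareIn⇒IsMatchingNumber≡0 sq (((a , b) ∷ _ , M-matching , _) , _)
    with ((1≤a , a≤p) , (1≤b , b≤p) , ab∉Q) ∷ _ ← edges M-matching
    = ⊥-elim (ab∉Q (sq a b 1≤a a≤p 1≤b b≤p))

  augment : ∀ {ℓ M a b} → IsMatching ℓ Q M →
            1 ≤ a → a ≤ ℓ → a ∉ map proj₁ M → (a , suc ℓ) ∉ Q →
            1 ≤ b → b ≤ ℓ → b ∉ map proj₂ M → (suc ℓ , b) ∉ Q →
            IsMatching (suc ℓ) Q ((a , suc ℓ) ∷ (suc ℓ , b) ∷ M)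
  augment {ℓ} M-matching 1≤a a≤ℓ a∉M a∉Q 1≤b b≤ℓ b∉M b∉Q = record
    { edges  = ((1≤a , m≤n⇒m≤1+n a≤ℓ) , (s≤s z≤n , ≤-refl) , a∉Q)
             ∷ ((s≤s z≤n , ≤-refl) , (1≤b , m≤n⇒m≤1+n b≤ℓ) , b∉Q)
             ∷ edges (IsMatching-mono (n≤1+n ℓ) M-matching)
    ; c-disj = (<⇒≢ (s≤s a≤ℓ) ∷ All.¬Any⇒All¬ _ a∉M)
             ∷ All.map⁺ (All.map (λ ((_ , c≤ℓ) , _) → >⇒≢ (s≤s c≤ℓ)) (edges M-matching))
             ∷ c-disj M-matching
    ; s-disj = (>⇒≢ (s≤s b≤ℓ) ∷ All.map⁺ (All.map (λ (_ , (_ , c≤ℓ) , _) → >⇒≢ (s≤s c≤ℓ)) (edges M-matching)))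
             ∷ All.¬Any⇒All¬ _ b∉M
             ∷ s-disj M-matching
    }

Incident : List Pair → ℕ → ℕ → Set
Incident Q d ℓ = (d , ℓ) ∈ Q ⊎ (ℓ , d) ∈ Q

module _ {Q : List Pair} (closedDown : ClosedDown Q) where
  open ClosedDown closedDown

  Incident-closed : ∀ {D d ℓ} → Incident Q D ℓ → 1 ≤ d → d ≤ D → Incident Q d ℓ
  Incident-closed (inj₁ Dℓ∈Q) 1≤d d≤D =
    inj₁ (closed _ _ _ _ Dℓ∈Q 1≤d d≤D (proj₂ (All.lookup positive Dℓ∈Q)) ≤-refl)
  Incident-closed (inj₂ ℓD∈Q) 1≤d d≤D =
    inj₂ (closed _ _ _ _ ℓD∈Q (proj₁ (All.lookup positive ℓD∈Q)) ≤-refl 1≤d d≤D)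

  unitStep⇒Incident : ∀ {ℓ m D} → IsMatchingNumber ℓ Q m → IsMatchingNumber (suc ℓ) Q (suc m) →
                      D + m ≡ ℓ → 1 ≤ D → Incident Q D (suc ℓ)
  unitStep⇒Incident {ℓ} {m} {D} ((M , M-matching , |M|≡m) , _) (_ , maximal) D+m≡ℓ 1≤D
    with (D , suc ℓ) ∈? Q | (suc ℓ , D) ∈? Q
  ... | yes D∈Q | _       = inj₁ D∈Q
  ... | no _    | yes D∈Q = inj₂ D∈Q
  ... | no D∉Q  | no D∉Q′
    with a , D≤a , a≤D+m , a∉M ← ∃∉-range′ D (map proj₁ M) (≤-reflexive (trans (length-map proj₁ M) |M|≡m))
       | b , D≤b , b≤D+m , b∉M ← ∃∉-range′ D (map proj₂ M) (≤-reflexive (trans (length-map proj₂ M) |M|≡m))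
    = ⊥-elim (1+n≰n (subst (_≤ suc m) (cong (suc ∘ suc) |M|≡m) (maximal _ augmented)))
    where
    augmented = augment M-matching
      (≤-trans 1≤D D≤a) (subst (a ≤_) D+m≡ℓ a≤D+m) a∉M
      (λ a∈Q → D∉Q (closed _ _ _ _ a∈Q 1≤D D≤a (s≤s z≤n) ≤-refl))
      (≤-trans 1≤D D≤b) (subst (b ≤_) D+m≡ℓ b≤D+m) b∉M
      (λ b∈Q → D∉Q′ (closed _ _ _ _ b∈Q (s≤s z≤n) ≤-refl 1≤D D≤b))

module Hooks {Q : List Pair} (closedDown : ClosedDown Q) (p : ℕ) (square : SquareIn p Q) where
  open ClosedDown closedDown

  -- Every pair of the hook of a row d ≤ p is labelled d, which makes hooks of distinct rows disjoint.
  hookOf : Pair → ℕ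
  hookOf (a , b) with a ≤? p
  ... | yes _ = a
  ... | no _  = b

  hookOf-row : ∀ {d b} → d ≤ p → hookOf (d , b) ≡ d
  hookOf-row {d} d≤p with d ≤? p
  ... | yes _   = refl
  ... | no d≰p = ⊥-elim (d≰p d≤p)

  hookOf-column : ∀ {a d} → p < a → hookOf (a , d) ≡ d
  hookOf-column {a} p<a with a ≤? p
  ... | yes a≤p = ⊥-elim (<⇒≱ p<a a≤p)
  ... | no _    = refl

  InSquare : Pair → Set
  InSquare (a , b) = a ≤ p × b ≤ p

  arm : ℕ → ℕ → List Pair
  arm d t with (d , t) ∈? Q
  ... | yes _ = map (d ,_) (range′ (suc p) (t ∸ p))
  ... | no _  = map (_, d) (range′ (suc p) (t ∸ p))

  length-arm : ∀ d t → length (arm d t) ≡ t ∸ p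
  length-arm d t with (d , t) ∈? Q
  ... | yes _ = trans (length-map (d ,_) (range′ (suc p) (t ∸ p))) (length-range′ (suc p) (t ∸ p))
  ... | no _  = trans (length-map (_, d) (range′ (suc p) (t ∸ p))) (length-range′ (suc p) (t ∸ p))

  arm-ok : ∀ {d t} → 1 ≤ d → d ≤ p → Incident Q d t →
           Unique (arm d t) × All (λ x → ¬ InSquare x × hookOf x ≡ d × x ∈ Q) (arm d t)
  arm-ok {d} {t} 1≤d d≤p incident with (d , t) ∈? Q | incident
  ... | yes dt∈Q | _ =
    Unique.map⁺ (cong proj₂) (Unique-range′ _ _) ,
    All.map⁺ (All-range′ λ p<b b<p+1+[t∸p] →
      (λ (_ , b≤p) → <⇒≱ p<b b≤p) , hookOf-row d≤p ,
      closed _ _ _ _ dt∈Q 1≤d ≤-refl (≤-trans (s≤s z≤n) p<b) (m<n≤m+[o∸m]⇒n≤o p<b (≤-pred b<p+1+[t∸p])))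
  ... | no dt∉Q | inj₁ dt∈Q = ⊥-elim (dt∉Q dt∈Q)
  ... | no _    | inj₂ td∈Q =
    Unique.map⁺ (cong proj₁) (Unique-range′ _ _) ,
    All.map⁺ (All-range′ λ p<a a<p+1+[t∸p] →
      (λ (a≤p , _) → <⇒≱ p<a a≤p) , hookOf-column p<a ,
      closed _ _ _ _ td∈Q (≤-trans (s≤s z≤n) p<a) (m<n≤m+[o∸m]⇒n≤o p<a (≤-pred a<p+1+[t∸p])) 1≤d ≤-refl)

  hook : ℕ → ℕ → List Pair
  hook d t = map (d ,_) (range′ 1 p) ++ arm d t

  length-hook : ∀ d t → length (hook d t) ≡ p + (t ∸ p)
  length-hook d t = begin
    length (hook d t)                               ≡⟨ length-++ (map (d ,_) (range′ 1 p)) ⟩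
    length (map (d ,_) (range′ 1 p)) + length (arm d t) ≡⟨ cong₂ _+_ row-length (length-arm d t) ⟩
    p + (t ∸ p)                                     ∎
    where
    open ≡-Reasoning
    row-length = trans (length-map (d ,_) (range′ 1 p)) (length-range′ 1 p)

  hook-ok : ∀ {d t} → 1 ≤ d → d ≤ p → Incident Q d t →
            Unique (hook d t) × All (λ x → hookOf x ≡ d × x ∈ Q) (hook d t)
  hook-ok {d} 1≤d d≤p incident =
    ++⁺-separated (Unique.map⁺ (cong proj₂) (Unique-range′ 1 p)) arm!
      (All.map proj₁ row) (All.map proj₁ arm-props) ,
    All.++⁺ (All.map proj₂ row) (All.map proj₂ arm-props)
    where
    arm! = proj₁ (arm-ok 1≤d d≤p incident)
    arm-props = proj₂ (arm-ok 1≤d d≤p incident)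
    row : All (λ x → InSquare x × hookOf x ≡ d × x ∈ Q) (map (d ,_) (range′ 1 p))
    row = All.map⁺ (All-range′ λ 1≤b b<1+p →
      (d≤p , ≤-pred b<1+p) , hookOf-row d≤p , square _ _ 1≤d d≤p 1≤b (≤-pred b<1+p))

  hooks : ℕ → List ℕ → List Pair
  hooks t = concatMap (λ d → hook d t)

  length-hooks : ∀ t ds → length (hooks t ds) ≡ length ds * (p + (t ∸ p))
  length-hooks t []       = refl
  length-hooks t (d ∷ ds) =
    trans (length-++ (hook d t)) (cong₂ _+_ (length-hook d t) (length-hooks t ds))

  hooks-ok : ∀ {t ds} → Unique ds → All (λ d → 1 ≤ d × d ≤ p × Incident Q d t) ds →
             Unique (hooks t ds) × All (λ x → hookOf x ∈ ds × x ∈ Q) (hooks t ds)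
  hooks-ok [] [] = [] , []
  hooks-ok {ds = d ∷ ds} (d∉ds ∷ ds!) ((1≤d , d≤p , incident) ∷ rows) =
    ++⁺-separated hook! rest! (All.map proj₁ hook-props)
      (All.map (λ (x∈ds , _) x≡d → All.lookup d∉ds (subst (_∈ ds) x≡d x∈ds) refl) rest-props) ,
    All.++⁺ (All.map (λ (x≡d , x∈Q) → here x≡d , x∈Q) hook-props)
            (All.map (λ (x∈ds , x∈Q) → there x∈ds , x∈Q) rest-props)
    where
    hook! = proj₁ (hook-ok 1≤d d≤p incident)
    hook-props = proj₂ (hook-ok 1≤d d≤p incident)
    rest! = proj₁ (hooks-ok ds! rows)
    rest-props = proj₂ (hooks-ok ds! rows)

constantIncrements⇒affine : ∀ (f : ℕ → ℕ) b n c →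
  (∀ i → b < i → i ≤ b + n → f i ≡ f (i ∸ 1) + c) → f (b + n) ≡ f b + n * c
constantIncrements⇒affine f b zero c _ = trans (cong f (+-identityʳ b)) (sym (+-identityʳ (f b)))
constantIncrements⇒affine f b (suc n) c step = begin
  f (b + suc n)       ≡⟨ cong f (+-suc b n) ⟩
  f (suc (b + n))     ≡⟨ step (suc (b + n)) (s≤s (m≤m+n b n)) (≤-reflexive (sym (+-suc b n))) ⟩
  f (b + n) + c       ≡⟨ cong (_+ c) (constantIncrements⇒affine f b n c step′) ⟩
  f b + n * c + c     ≡⟨ +-assoc (f b) (n * c) c ⟩
  f b + (n * c + c)   ≡⟨ cong (f b +_) (+-comm (n * c) c) ⟩
  f b + suc n * c     ∎
  where
  open ≡-Reasoning
  step′ : ∀ i → b < i → i ≤ b + n → f i ≡ f (i ∸ 1) + c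
  step′ i b<i i≤b+n = step i b<i (≤-trans i≤b+n (+-monoʳ-≤ b (n≤1+n n)))

module Staircase {Q : List Pair} (closedDown : ClosedDown Q)
  (ν : ℕ → ℕ) (ν-matching : ∀ ℓ → IsMatchingNumber ℓ Q (ν ℓ))
  (p : ℕ) (square : SquareIn p Q) (k : ℕ) (I II : ℕ → ℕ)
  (I-positive : ∀ j → 1 ≤ j → j < k → 1 ≤ I j)
  (O₀-step : ∀ ℓ → p < ℓ → ℓ ≤ p + I 0 → ν ℓ ≡ ν (ℓ ∸ 1) + 1)
  (T-step : ∀ j ℓ → 1 ≤ j → j ≤ k → tStart p I II j < ℓ → ℓ ≤ tStart p I II j + II j →
            ν ℓ ≡ ν (ℓ ∸ 1) + 2)
  (O-step : ∀ j ℓ → 1 ≤ j → j < k → tStart p I II j + II j < ℓ →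
            ℓ ≤ tStart p I II (suc j) → ν ℓ ≡ ν (ℓ ∸ 1) + 1)
  where
  open Hooks closedDown p square

  t : ℕ → ℕ
  t = tStart p I II

  S : ℕ → ℕ
  S j = sumTo j II

  -- From here on, index j refers to 𝒯_{j+1}, which starts at t (suc j).

  p≤t : ∀ j → p ≤ t j
  p≤t j = ≤-trans (m≤m+n p (I 0)) (m≤m+n _ _)

  t-suc : ∀ j → t (suc (suc j)) ≡ t (suc j) + II (suc j) + I (suc j)
  t-suc j = trans (sym (+-assoc (p + I 0) _ (II (suc j) + I (suc j))))
                  (sym (+-assoc (t (suc j)) (II (suc j)) (I (suc j))))

  ν-across-T : ∀ j → suc j ≤ k → ν (t (suc j) + II (suc j)) ≡ ν (t (suc j)) + II (suc j) * 2
  ν-across-T j j<k = constantIncrements⇒affine ν (t (suc j)) (II (suc j)) 2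
    (λ ℓ → T-step (suc j) ℓ (s≤s z≤n) j<k)

  ν-across-O : ∀ j → suc j < k → ν (t (suc (suc j))) ≡ ν (t (suc j) + II (suc j)) + I (suc j) * 1
  ν-across-O j 1+j<k = trans (cong ν (t-suc j))
    (constantIncrements⇒affine ν (t (suc j) + II (suc j)) (I (suc j)) 1 λ ℓ below above →
      O-step (suc j) ℓ (s≤s z≤n) 1+j<k below (subst (ℓ ≤_) (sym (t-suc j)) above))

  ν-t : ∀ j → suc j ≤ k → ν (t (suc j)) + p ≡ t (suc j) + S j
  ν-t zero _ = begin
    ν (p + I 0 + 0) + p   ≡⟨ cong (λ ℓ → ν ℓ + p) (+-identityʳ (p + I 0)) ⟩
    ν (p + I 0) + p       ≡⟨ cong (_+ p) (constantIncrements⇒affine ν p (I 0) 1 O₀-step) ⟩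
    ν p + I 0 * 1 + p     ≡⟨ cong (λ n → n + I 0 * 1 + p) ν-p≡0 ⟩
    I 0 * 1 + p           ≡⟨ rearrange (I 0) p ⟩
    p + I 0 + 0 + 0       ∎
    where
    open ≡-Reasoning
    ν-p≡0 : ν p ≡ 0
    ν-p≡0 = SquareIn⇒IsMatchingNumber≡0 square (ν-matching p)
    rearrange : ∀ i p → i * 1 + p ≡ p + i + 0 + 0
    rearrange = solve-∀
  ν-t (suc j) 1+j<k = begin
    ν (t (suc (suc j))) + p                    ≡⟨ cong (_+ p) (ν-across-O j 1+j<k) ⟩
    ν (t (suc j) + y) + x * 1 + p              ≡⟨ cong (λ n → n + x * 1 + p) (ν-across-T j (<⇒≤ 1+j<k)) ⟩
    ν (t (suc j)) + y * 2 + x * 1 + p          ≡⟨ rearrange₁ (ν (t (suc j))) p y x ⟩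
    (ν (t (suc j)) + p) + y * 2 + x * 1        ≡⟨ cong (λ n → n + y * 2 + x * 1) (ν-t j (<⇒≤ 1+j<k)) ⟩
    t (suc j) + S j + y * 2 + x * 1            ≡⟨ rearrange₂ (t (suc j)) (S j) y x ⟩
    (t (suc j) + y + x) + (S j + y)            ≡⟨ cong (_+ (S j + y)) (t-suc j) ⟨
    t (suc (suc j)) + S (suc j)                ∎
    where
    open ≡-Reasoning
    x = I (suc j)
    y = II (suc j)
    rearrange₁ : ∀ v p y x → v + y * 2 + x * 1 + p ≡ (v + p) + y * 2 + x * 1
    rearrange₁ = solve-∀
    rearrange₂ : ∀ t s y x → t + s + y * 2 + x * 1 ≡ (t + y + x) + (s + y)
    rearrange₂ = solve-∀

  S-suc≤p : ∀ j → suc j ≤ k → S (suc j) ≤ p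
  S-suc≤p j j<k = +-cancelˡ-≤ (t (suc j) + y) _ _ (begin
    (t (suc j) + y) + (S j + y)    ≡⟨ rearrange₁ (t (suc j)) (S j) y ⟩
    (t (suc j) + S j) + y * 2      ≡⟨ cong (_+ y * 2) (ν-t j j<k) ⟨
    ν (t (suc j)) + p + y * 2      ≡⟨ rearrange₂ (ν (t (suc j))) p y ⟩
    (ν (t (suc j)) + y * 2) + p    ≡⟨ cong (_+ p) (ν-across-T j j<k) ⟨
    ν (t (suc j) + y) + p          ≤⟨ +-monoˡ-≤ p (IsMatchingNumber⇒≤ (ν-matching _)) ⟩
    (t (suc j) + y) + p            ∎)
    where
    open ≤-Reasoning
    y = II (suc j)
    rearrange₁ : ∀ t s y → (t + y) + (s + y) ≡ (t + s) + y * 2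
    rearrange₁ = solve-∀
    rearrange₂ : ∀ v p y → v + p + y * 2 ≡ (v + y * 2) + p
    rearrange₂ = solve-∀

  S≤p : ∀ j → suc j ≤ k → S j ≤ p
  S≤p j j<k = ≤-trans (m≤m+n (S j) (II (suc j))) (S-suc≤p j j<k)

  deficiency-t : ∀ j → suc j ≤ k → (p ∸ S j) + ν (t (suc j)) ≡ t (suc j)
  deficiency-t j j<k = +-cancelʳ-≡ (S j) _ _ (begin
    (p ∸ S j) + ν (t (suc j)) + S j    ≡⟨ rearrange (p ∸ S j) (ν (t (suc j))) (S j) ⟩
    ν (t (suc j)) + ((p ∸ S j) + S j)  ≡⟨ cong (ν (t (suc j)) +_) (m∸n+n≡m (S≤p j j<k)) ⟩
    ν (t (suc j)) + p                  ≡⟨ ν-t j j<k ⟩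
    t (suc j) + S j                    ∎)
    where
    open ≡-Reasoning
    rearrange : ∀ a b c → a + b + c ≡ b + (a + c)
    rearrange = solve-∀

  ν-unitStep⇒Incident : ∀ ℓ D → p < ℓ → ν ℓ ≡ ν (ℓ ∸ 1) + 1 → D + ν ℓ ≡ ℓ → 1 ≤ D →
                       Incident Q D ℓ
  ν-unitStep⇒Incident (suc ℓ) D _ step D+ν≡ℓ 1≤D =
    unitStep⇒Incident closedDown (ν-matching ℓ)
      (subst (IsMatchingNumber (suc ℓ) Q) step′ (ν-matching (suc ℓ))) D+νℓ≡ℓ 1≤D
    where
    step′ : ν (suc ℓ) ≡ suc (ν ℓ)
    step′ = trans step (+-comm (ν ℓ) 1)
    D+νℓ≡ℓ : D + ν ℓ ≡ ℓ
    D+νℓ≡ℓ = suc-injective (trans (sym (+-suc D (ν ℓ))) (trans (cong (D +_) (sym step′)) D+ν≡ℓ))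

  Incident-deficiency : ∀ j → suc j ≤ k → 1 ≤ p ∸ S j → Incident Q (p ∸ S j) (t (suc j))
  Incident-deficiency zero 0<k 1≤p with I 0 ≟ 0
  ... | yes I₀≡0 = inj₁ (subst (λ ℓ → (p , ℓ) ∈ Q) (sym t₁≡p) (square p p 1≤p ≤-refl 1≤p ≤-refl))
    where
    t₁≡p : t 1 ≡ p
    t₁≡p = trans (+-identityʳ (p + I 0)) (trans (cong (p +_) I₀≡0) (+-identityʳ p))
  ... | no I₀≢0 = ν-unitStep⇒Incident (t 1) p p<t₁
    (O₀-step (t 1) p<t₁ (≤-reflexive (+-identityʳ (p + I 0)))) (deficiency-t zero 0<k) 1≤p
    where
    p<t₁ : p < t 1
    p<t₁ = subst (p <_) (sym (+-identityʳ (p + I 0))) (m<m+n p (n≢0⇒n>0 I₀≢0))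
  Incident-deficiency (suc j) 1+j<k 1≤D = ν-unitStep⇒Incident (t (suc (suc j))) (p ∸ S (suc j))
    (≤-<-trans (≤-trans (p≤t (suc j)) (m≤m+n _ _)) O-start<t)
    (O-step (suc j) _ (s≤s z≤n) 1+j<k O-start<t ≤-refl) (deficiency-t (suc j) 1+j<k) 1≤D
    where
    O-start<t : t (suc j) + II (suc j) < t (suc (suc j))
    O-start<t = subst (t (suc j) + II (suc j) <_) (sym (t-suc j))
                  (m<m+n _ (I-positive (suc j) (s≤s z≤n) 1+j<k))

  block : ℕ → List ℕ
  block j = range′ (suc (p ∸ S (suc j))) (II (suc j))

  ∈-block⁻ : ∀ {j d} → suc j ≤ k → d ∈ block j → p ∸ S (suc j) < d × d ≤ p ∸ S j
  ∈-block⁻ {j} {d} j<k d∈ with lo<d , d<lo+1+y ← ∈-range′⁻ d∈ =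
    lo<d , subst (d ≤_) lo+y≡p∸Sj (≤-pred d<lo+1+y)
    where
    y≤p∸Sj : II (suc j) ≤ p ∸ S j
    y≤p∸Sj = m+n≤o⇒m≤o∸n (II (suc j)) (subst (_≤ p) (+-comm (S j) _) (S-suc≤p j j<k))
    lo+y≡p∸Sj : p ∸ S (suc j) + II (suc j) ≡ p ∸ S j
    lo+y≡p∸Sj = trans (cong (_+ II (suc j)) (sym (∸-+-assoc p (S j) (II (suc j))))) (m∸n+n≡m y≤p∸Sj)

  staircase : ℕ → List Pair
  staircase zero    = []
  staircase (suc j) = staircase j ++ hooks (t (suc j)) (block j)

  staircase-ok : ∀ j → j ≤ k →
                 Unique (staircase j) × All (λ x → p ∸ S j < hookOf x × x ∈ Q) (staircase j)
  staircase-ok zero    _   = [] , []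
  staircase-ok (suc j) j<k =
    ++⁺-separated old! new! (All.map proj₁ old-props)
      (All.map (λ (d∈ , _) → ≤⇒≯ (proj₂ (∈-block⁻ j<k d∈))) new-props) ,
    All.++⁺ (All.map (λ (Sj<d , x∈Q) → ≤-<-trans (∸-monoʳ-≤ p (m≤m+n (S j) _)) Sj<d , x∈Q) old-props)
            (All.map (λ (d∈ , x∈Q) → proj₁ (∈-block⁻ j<k d∈) , x∈Q) new-props)
    where
    old! = proj₁ (staircase-ok j (<⇒≤ j<k))
    old-props = proj₂ (staircase-ok j (<⇒≤ j<k))
    rows : All (λ d → 1 ≤ d × d ≤ p × Incident Q d (t (suc j))) (block j)
    rows = All.tabulate λ d∈ →
      let lo<d , d≤p∸Sj = ∈-block⁻ j<k d∈
          1≤d = ≤-trans (s≤s z≤n) lo<d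
      in 1≤d , ≤-trans d≤p∸Sj (m∸n≤m p (S j)) ,
         Incident-closed closedDown (Incident-deficiency j j<k (≤-trans 1≤d d≤p∸Sj)) 1≤d d≤p∸Sj
    new! = proj₁ (hooks-ok (Unique-range′ _ _) rows)
    new-props = proj₂ (hooks-ok (Unique-range′ _ _) rows)

  length-staircase : ∀ j → sumTo j (λ i → II i * t i) ≤ length (staircase j)
  length-staircase zero    = z≤n
  length-staircase (suc j) = begin
    sumTo j (λ i → II i * t i) + II (suc j) * t (suc j)
      ≤⟨ +-mono-≤ (length-staircase j)
                  (*-mono-≤ (≤-reflexive (sym (length-range′ _ (II (suc j))))) (m≤n+m∸n (t (suc j)) p)) ⟩
    length (staircase j) + length (block j) * (p + (t (suc j) ∸ p))
      ≡⟨ cong (length (staircase j) +_) (length-hooks (t (suc j)) (block j)) ⟨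
    length (staircase j) + length (hooks (t (suc j)) (block j))
      ≡⟨ length-++ (staircase j) ⟨
    length (staircase (suc j)) ∎
    where open ≤-Reasoning

lemma4p8 : (Q : List Pair) → ClosedDown Q →
    (ν : ℕ → ℕ) → (∀ ℓ → IsMatchingNumber ℓ Q (ν ℓ)) →
    (p : ℕ) → SquareIn p Q → (∀ p′ → SquareIn p′ Q → p′ ≤ p) →
    (q : ℕ) → (∀ ℓ → p + q ≤ ℓ → ν ℓ ≡ ℓ) →
    (∀ q′ → (∀ ℓ → p + q′ ≤ ℓ → ν ℓ ≡ ℓ) → q ≤ q′) →
    (k : ℕ) (I II : ℕ → ℕ) →
    (∀ j → 1 ≤ j → j < k → 1 ≤ I j) →
    (∀ j → 1 ≤ j → j ≤ k → 1 ≤ II j) →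
    ((k ≡ 0 × q ≡ 0) ⊎ (1 ≤ k × tStart p I II k + II k ≡ p + q)) →
    (∀ ℓ → p < ℓ → ℓ ≤ p + I 0 → ν ℓ ≡ ν (ℓ ∸ 1) + 1) →
    (∀ j ℓ → 1 ≤ j → j ≤ k → tStart p I II j < ℓ → ℓ ≤ tStart p I II j + II j →
      ν ℓ ≡ ν (ℓ ∸ 1) + 2) →
    (∀ j ℓ → 1 ≤ j → j < k → tStart p I II j + II j < ℓ →
      ℓ ≤ tStart p I II (suc j) → ν ℓ ≡ ν (ℓ ∸ 1) + 1) →
    sumTo k (λ j → II j * tStart p I II j) ≤ length Q
lemma4p8 Q closedDown ν ν-matching p square _ _ _ _ k I II I-positive _ _ O₀-step T-step O-step =
  ≤-trans (length-staircase k) (Unique⇒length≤ staircase! (All.map proj₂ staircase-props))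
  where
  open Staircase closedDown ν ν-matching p square k I II I-positive O₀-step T-step O-step
  staircase! = proj₁ (staircase-ok k ≤-refl)
  staircase-props = proj₂ (staircase-ok k ≤-refl)
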